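{- Let $G=(V,E)$ be a graph and let $f=(B_0,B_1,B_2)$ be a $\gamma_R(G)$-function. Then for every $v\in V$: (i) if $v\in B_0$, then $\gamma_R(G)-1\le\gamma_R(G-v)\le\gamma_R(G)$; (ii) if $v\in B_1$, then $\gamma_R(G-v)=\gamma_R(G)-1$; (iii) if $v\in B_2$, then $\gamma_R(G)-1\le\gamma_R(G-v)\le\gamma_R(G)+\delta(v)-2$, where $\delta(v)$ is the degree of $v$ in $G$.
   Context: All graphs are finite, simple and undirected. A Roman dominating function on $G=(V,E)$ is a map $f:V\to\{0,1,2\}$ such that every vertex $u$ with $f(u)=0$ has a neighbor $w$ with $f(w)=2$; its weight is $\sum_{u\in V}f(u)$; $\gamma_R(G)$ is the minimum weight, and a $\gamma_R(G)$-function is a Roman dominating function of weight $\gamma_R(G)$. One writes $f=(B_0,B_1,B_2)$ where $B_k=\{u\in V: f(u)=k\}$. $G-v$ is $G$ with vertex $v$ deleted. -}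

module Defs where

open import Data.Nat using (ℕ; zero; suc; _+_; _≤_)
open import Data.Bool using (Bool; true; false; if_then_else_)
open import Data.Fin using (Fin; punchIn)
open import Data.List using (List; map)
open import Data.Nat.ListAction using (sum)
open import Data.List.Base using (allFin)
open import Data.Product using (Σ; _×_; ∃)
open import Relation.Binary.PropositionalEquality using (_≡_)

record Graph (n : ℕ) : Set where
  field
    Adj   : Fin n → Fin n → Bool
    sym   : ∀ u w → Adj u w ≡ Adj w u
    irefl : ∀ u → Adj u u ≡ false
open Graph public

degree : ∀ {n} → Graph n → Fin n → ℕ
degree {n} G v = sum (map (λ w → if Adj G v w then 1 else 0) (allFin n))

-- G - v : delete vertex v; the remaining vertices are re-indexed by Fin m
-- via punchIn v (an order-preserving bijection onto Fin (suc m) ∖ {v}).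
deleteVertex : ∀ {m} → Graph (suc m) → Fin (suc m) → Graph m
deleteVertex G v = record
  { Adj   = λ i j → Adj G (punchIn v i) (punchIn v j)
  ; sym   = λ i j → sym G (punchIn v i) (punchIn v j)
  ; irefl = λ i → irefl G (punchIn v i)
  }

weight : ∀ {n} → (Fin n → ℕ) → ℕ
weight {n} f = sum (map f (allFin n))

IsRDF : ∀ {n} → Graph n → (Fin n → ℕ) → Set
IsRDF {n} G f =
  (∀ u → f u ≤ 2) ×
  (∀ u → f u ≡ 0 → ∃ λ w → Adj G u w ≡ true × f w ≡ 2)

IsGammaRFunction : ∀ {n} → Graph n → (Fin n → ℕ) → Set
IsGammaRFunction {n} G f =
  IsRDF G f × (∀ (g : Fin n → ℕ) → IsRDF G g → weight f ≤ weight g)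

module Submission where

-- All three parts of the theorem
-- follow from three ways of transporting Roman dominating functions (RDFs)
-- between G and G - v:
--   * insertion: an RDF g of G - v, extended by the label 1 at v, is an RDF
--     of G of weight w(g) + 1; hence γ_R(G) ≤ γ_R(G - v) + 1 always;
--   * restriction: if f(v) ≠ 2, then f restricted to G - v is an RDF, so
--     γ_R(G - v) + f(v) ≤ w(f)  (this gives the upper bounds in (i), (ii));
--   * raising: restricting f and raising every 0-labelled neighbour of v to 1
--     gives an RDF of G - v of weight ≤ w(f) - f(v) + δ(v)  (part (iii)).
-- Since the statement also asks for a γ_R(G - v)-function, we first show that
-- any graph with an RDF has a γ_R-function: an RDF of least weight among the
-- finitely many {0,1,2}-labellings exists.

open import Defs hiding (sym)
open import Data.Nat using (ℕ; zero; suc; _+_; _≤_; _⊔_; _≤?_; _≟_; z≤n; s≤s)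
open import Data.Nat.Properties
  using ( ≤-reflexive; ≤-antisym; ≤-totalOrder; +-mono-≤; +-monoˡ-≤
        ; +-comm; +-identityʳ; ⊔-lub; m⊔n≤m+n; 1+n≢0; +-0-commutativeMonoid
        ; +-commutativeSemigroup; module ≤-Reasoning)
open import Data.Nat.ListAction using (sum)
open import Data.Fin using (Fin; zero; suc; punchIn; punchOut) renaming (_≟_ to _≟ᶠ_)
open import Data.Fin.Properties using (punchIn-punchOut; any?; all?)
open import Data.Bool using (Bool; true; false; if_then_else_)
import Data.Bool.Properties as Bool
open import Data.Vec.Functional using (insertAt; removeAt) renaming (_∷_ to _◂_)
open import Data.Vec.Functional.Properties using (insertAt-lookup; insertAt-punchIn; removeAt-insertAt)
open import Data.List using (List; []; _∷_; map; tabulate; allFin; filter; cartesianProductWith)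
open import Data.List.Properties using (map-cong; map-tabulate)
open import Data.List.Membership.Propositional using (_∈_)
open import Data.List.Membership.Propositional.Properties using (∈-cartesianProductWith⁺; ∈-filter⁺)
open import Data.List.Relation.Unary.Any using (here; there)
import Data.List.Relation.Unary.All as All
open import Data.List.Relation.Unary.All.Properties using (all-filter)
open import Data.List.Extrema ≤-totalOrder using (argmin; argmin-all; f[argmin]≤f[xs])
open import Algebra.Properties.CommutativeMonoid.Sum +-0-commutativeMonoid
  using (sum-remove; ∑-distrib-+) renaming (sum to ∑)
open import Algebra.Properties.CommutativeSemigroup +-commutativeSemigroup using (xy∙z≈xz∙y)
open import Data.Product using (Σ; _×_; ∃; _,_; proj₁; proj₂)
open import Data.Sum using (_⊎_; inj₁; inj₂)
open import Relation.Nullary using (Dec; yes; no; contradiction)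
open import Relation.Nullary.Decidable using (_×-dec_; _→-dec_)
open import Relation.Binary.PropositionalEquality
  using (_≡_; _≢_; _≗_; refl; sym; trans; cong; cong₂; subst; subst₂; module ≡-Reasoning)
open import Function using (_∘_)

-- The list-based weight of Defs agrees with the vector sum of the
-- algebra library, so the library's summation lemmas apply to it.
weight≡∑ : ∀ {n} (f : Fin n → ℕ) → weight f ≡ ∑ f
weight≡∑ f = trans (cong sum (map-tabulate (λ i → i) f)) (sum-tabulate f)
  where
  sum-tabulate : ∀ {n} (h : Fin n → ℕ) → sum (tabulate h) ≡ ∑ h
  sum-tabulate {zero}  h = refl
  sum-tabulate {suc n} h = cong (h zero +_) (sum-tabulate (h ∘ suc))

weight-cong : ∀ {n} {f g : Fin n → ℕ} → f ≗ g → weight f ≡ weight g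
weight-cong {n} f≗g = cong sum (map-cong f≗g (allFin n))

weight-mono : ∀ {n} {f g : Fin n → ℕ} → (∀ i → f i ≤ g i) → weight f ≤ weight g
weight-mono {f = f} {g} f≤g =
  subst₂ _≤_ (sym (weight≡∑ f)) (sym (weight≡∑ g)) (∑-mono f≤g)
  where
  ∑-mono : ∀ {n} {f g : Fin n → ℕ} → (∀ i → f i ≤ g i) → ∑ f ≤ ∑ g
  ∑-mono {zero}  _   = z≤n
  ∑-mono {suc n} f≤g = +-mono-≤ (f≤g zero) (∑-mono (f≤g ∘ suc))

weight-+ : ∀ {n} (f g : Fin n → ℕ) → weight (λ i → f i + g i) ≡ weight f + weight g
weight-+ f g = begin
  weight (λ i → f i + g i) ≡⟨ weight≡∑ (λ i → f i + g i) ⟩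
  ∑ (λ i → f i + g i)      ≡⟨ ∑-distrib-+ f g ⟩
  ∑ f + ∑ g                ≡⟨ sym (cong₂ _+_ (weight≡∑ f) (weight≡∑ g)) ⟩
  weight f + weight g      ∎
  where open ≡-Reasoning

weight-removeAt : ∀ {m} (f : Fin (suc m) → ℕ) (v : Fin (suc m)) →
                  weight f ≡ f v + weight (removeAt f v)
weight-removeAt f v = begin
  weight f                     ≡⟨ weight≡∑ f ⟩
  ∑ f                          ≡⟨ sum-remove f ⟩
  f v + ∑ (removeAt f v)       ≡⟨ cong (f v +_) (sym (weight≡∑ (removeAt f v))) ⟩
  f v + weight (removeAt f v)  ∎
  where open ≡-Reasoning

weight-insertAt : ∀ {m} (g : Fin m → ℕ) (v : Fin (suc m)) (k : ℕ) →
                  weight (insertAt g v k) ≡ k + weight g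
weight-insertAt g v k =
  trans (weight-removeAt (insertAt g v k) v)
        (cong₂ _+_ (insertAt-lookup g v k) (weight-cong (removeAt-insertAt g v k)))

indicator : Bool → ℕ
indicator b = if b then 1 else 0

-- The degree of v is the number of its neighbours among the other vertices
-- (v is not adjacent to itself).
degree-removeAt : ∀ {m} (G : Graph (suc m)) (v : Fin (suc m)) →
                  degree G v ≡ weight (λ i → indicator (Adj G v (punchIn v i)))
degree-removeAt G v =
  trans (weight-removeAt (indicator ∘ Adj G v) v) (cong (λ b → indicator b + others) (irefl G v))
  where
  others : ℕ
  others = weight (λ i → indicator (Adj G v (punchIn v i)))

labellings : ∀ n → List (Fin n → ℕ)
labellings zero    = (λ ()) ∷ []
labellings (suc n) = cartesianProductWith _◂_ (0 ∷ 1 ∷ 2 ∷ []) (labellings n)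

labellings-complete : ∀ {n} (g : Fin n → ℕ) → (∀ u → g u ≤ 2) →
                      ∃ λ h → h ∈ labellings n × h ≗ g
labellings-complete {zero}  g _   = _ , here refl , λ ()
labellings-complete {suc n} g g≤2 with labellings-complete (g ∘ suc) (g≤2 ∘ suc)
... | h , h∈ , h≗g =
  g zero ◂ h ,
  ∈-cartesianProductWith⁺ _◂_ (≤2⇒∈ (g≤2 zero)) h∈ ,
  λ { zero → refl ; (suc i) → h≗g i }
  where
  ≤2⇒∈ : ∀ {k} → k ≤ 2 → k ∈ 0 ∷ 1 ∷ 2 ∷ []
  ≤2⇒∈ z≤n             = here refl
  ≤2⇒∈ (s≤s z≤n)       = there (here refl)
  ≤2⇒∈ (s≤s (s≤s z≤n)) = there (there (here refl))

IsRDF-resp : ∀ {n} (G : Graph n) {f g : Fin n → ℕ} → f ≗ g → IsRDF G f → IsRDF G g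
IsRDF-resp G f≗g (f≤2 , f-dom) =
  (λ u → subst (_≤ 2) (f≗g u) (f≤2 u)) ,
  λ u g0 → let (w , adj , f2) = f-dom u (trans (f≗g u) g0)
           in w , adj , trans (sym (f≗g w)) f2

-- Being an RDF is decidable, so RDFs can be filtered out of a list.
IsRDF? : ∀ {n} (G : Graph n) (f : Fin n → ℕ) → Dec (IsRDF G f)
IsRDF? G f =
  all? (λ u → f u ≤? 2) ×-dec
  all? (λ u → (f u ≟ 0) →-dec any? (λ w → (Adj G u w Bool.≟ true) ×-dec (f w ≟ 2)))

-- A lightest RDF among the listed labellings is a γ_R-function; the given
-- RDF h guarantees that the search space is non-empty.
gammaRFunction-exists : ∀ {n} (G : Graph n) (h : Fin n → ℕ) → IsRDF G h →
                        Σ (Fin n → ℕ) (IsGammaRFunction G)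
gammaRFunction-exists {n} G h h-rdf = best , best-rdf , best-min
  where
  candidates : List (Fin n → ℕ)
  candidates = filter (IsRDF? G) (labellings n)

  best : Fin n → ℕ
  best = argmin weight h candidates

  best-rdf : IsRDF G best
  best-rdf = argmin-all weight h-rdf (all-filter (IsRDF? G) (labellings n))

  best-min : ∀ g → IsRDF G g → weight best ≤ weight g
  best-min g g-rdf with labellings-complete g (proj₁ g-rdf)
  ... | g′ , g′∈ , g′≗g = begin
    weight best ≤⟨ All.lookup (f[argmin]≤f[xs] {f = weight} h candidates)
                     (∈-filter⁺ (IsRDF? G) g′∈ (IsRDF-resp G (sym ∘ g′≗g) g-rdf)) ⟩
    weight g′   ≡⟨ weight-cong g′≗g ⟩
    weight g    ∎
    where open ≤-Reasoning

vertex-cases : ∀ {m} (v u : Fin (suc m)) → v ≡ u ⊎ ∃ λ i → punchIn v i ≡ u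
vertex-cases v u with v ≟ᶠ u
... | yes v≡u = inj₁ v≡u
... | no  v≢u = inj₂ (punchOut v≢u , punchIn-punchOut v≢u)

raiseIf : Bool → ℕ → ℕ
raiseIf b k = if b then k ⊔ 1 else k

raiseIf-≤2 : ∀ b {k} → k ≤ 2 → raiseIf b k ≤ 2
raiseIf-≤2 true  k≤2 = ⊔-lub k≤2 (s≤s z≤n)
raiseIf-≤2 false k≤2 = k≤2

raiseIf-0 : ∀ b k → raiseIf b k ≡ 0 → b ≡ false × k ≡ 0
raiseIf-0 true  zero    ()
raiseIf-0 true  (suc k) ()
raiseIf-0 false k       k≡0 = refl , k≡0

raiseIf-2 : ∀ b → raiseIf b 2 ≡ 2
raiseIf-2 true  = refl
raiseIf-2 false = refl

raiseIf-≤ : ∀ b k → raiseIf b k ≤ k + indicator b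
raiseIf-≤ true  k = m⊔n≤m+n k 1
raiseIf-≤ false k = ≤-reflexive (sym (+-identityʳ k))

module _ {m} (G : Graph (suc m)) (v : Fin (suc m)) where

  private
    G-v : Graph m
    G-v = deleteVertex G v

  insert-RDF : ∀ {g} → IsRDF G-v g → IsRDF G (insertAt g v 1)
  insert-RDF {g} (g≤2 , g-dom) = bound , dom
    where
    bound : ∀ u → insertAt g v 1 u ≤ 2
    bound u with vertex-cases v u
    ... | inj₁ refl       rewrite insertAt-lookup g v 1   = s≤s z≤n
    ... | inj₂ (i , refl) rewrite insertAt-punchIn g v 1 i = g≤2 i

    dom : ∀ u → insertAt g v 1 u ≡ 0 → ∃ λ w → Adj G u w ≡ true × insertAt g v 1 w ≡ 2
    dom u u0 with vertex-cases v u
    ... | inj₁ refl = contradiction (trans (sym (insertAt-lookup g v 1)) u0) 1+n≢0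
    ... | inj₂ (i , refl) with g-dom i (trans (sym (insertAt-punchIn g v 1 i)) u0)
    ...   | j , adj , g2 = punchIn v j , adj , trans (insertAt-punchIn g v 1 j) g2

  -- Restriction: if v is not labelled 2, no other vertex relies on v.
  restrict-RDF : ∀ {f} → f v ≢ 2 → IsRDF G f → IsRDF G-v (removeAt f v)
  restrict-RDF {f} fv≢2 (f≤2 , f-dom) = f≤2 ∘ punchIn v , dom
    where
    dom : ∀ i → f (punchIn v i) ≡ 0 →
          ∃ λ j → Adj G (punchIn v i) (punchIn v j) ≡ true × f (punchIn v j) ≡ 2
    dom i i0 with f-dom (punchIn v i) i0
    ... | w , adj , f2 with vertex-cases v w
    ...   | inj₁ refl       = contradiction f2 fv≢2
    ...   | inj₂ (j , refl) = j , adj , f2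

  -- Raising: restrict f and raise the 0-labelled neighbours of v to 1,
  -- since they may have been dominated by v alone.
  raise : (Fin (suc m) → ℕ) → Fin m → ℕ
  raise f i = raiseIf (Adj G v (punchIn v i)) (f (punchIn v i))

  raise-RDF : ∀ {f} → IsRDF G f → IsRDF G-v (raise f)
  raise-RDF {f} (f≤2 , f-dom) = bound , dom
    where
    bound : ∀ i → raise f i ≤ 2
    bound i = raiseIf-≤2 (Adj G v (punchIn v i)) (f≤2 (punchIn v i))

    dom : ∀ i → raise f i ≡ 0 →
          ∃ λ j → Adj G (punchIn v i) (punchIn v j) ≡ true × raise f j ≡ 2
    dom i i0 with raiseIf-0 (Adj G v (punchIn v i)) (f (punchIn v i)) i0
    ... | not-adj , fi0 with f-dom (punchIn v i) fi0
    ...   | w , adj , f2 with vertex-cases v w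
    ...     | inj₁ refl =
      contradiction (trans (sym adj) (trans (Graph.sym G (punchIn v i) v) not-adj)) λ ()
    ...     | inj₂ (j , refl) =
      j , adj , trans (cong (raiseIf _) f2) (raiseIf-2 (Adj G v (punchIn v j)))

  raise-weight : ∀ f → weight (raise f) ≤ weight (removeAt f v) + degree G v
  raise-weight f = begin
    weight (raise f)                                   ≤⟨ weight-mono (λ i → raiseIf-≤ (adj i) (f (punchIn v i))) ⟩
    weight (λ i → f (punchIn v i) + indicator (adj i)) ≡⟨ weight-+ (removeAt f v) (indicator ∘ adj) ⟩
    weight (removeAt f v) + weight (indicator ∘ adj)   ≡⟨ cong (weight (removeAt f v) +_) (sym (degree-removeAt G v)) ⟩
    weight (removeAt f v) + degree G v                 ∎
    where
    open ≤-Reasoning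
    adj : Fin m → Bool
    adj i = Adj G v (punchIn v i)

  gamma-le-insert : ∀ {f g} → IsGammaRFunction G f → IsRDF G-v g → weight f ≤ weight g + 1
  gamma-le-insert {f} {g} (_ , f-min) g-rdf = begin
    weight f                ≤⟨ f-min (insertAt g v 1) (insert-RDF g-rdf) ⟩
    weight (insertAt g v 1) ≡⟨ weight-insertAt g v 1 ⟩
    1 + weight g            ≡⟨ +-comm 1 (weight g) ⟩
    weight g + 1            ∎
    where open ≤-Reasoning

  gamma-le-restrict : ∀ {f g} → IsGammaRFunction G-v g → IsRDF G f → f v ≢ 2 →
                      weight g + f v ≤ weight f
  gamma-le-restrict {f} {g} (_ , g-min) f-rdf fv≢2 = begin
    weight g + f v              ≤⟨ +-monoˡ-≤ (f v) (g-min (removeAt f v) (restrict-RDF fv≢2 f-rdf)) ⟩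
    weight (removeAt f v) + f v ≡⟨ +-comm (weight (removeAt f v)) (f v) ⟩
    f v + weight (removeAt f v) ≡⟨ sym (weight-removeAt f v) ⟩
    weight f                    ∎
    where open ≤-Reasoning

  gamma-le-raise : ∀ {f g} → IsGammaRFunction G-v g → IsRDF G f →
                   weight g + f v ≤ weight f + degree G v
  gamma-le-raise {f} {g} (_ , g-min) f-rdf = begin
    weight g + f v                           ≤⟨ +-monoˡ-≤ (f v) (g-min (raise f) (raise-RDF f-rdf)) ⟩
    weight (raise f) + f v                   ≤⟨ +-monoˡ-≤ (f v) (raise-weight f) ⟩
    weight (removeAt f v) + degree G v + f v ≡⟨ xy∙z≈xz∙y (weight (removeAt f v)) (degree G v) (f v) ⟩
    weight (removeAt f v) + f v + degree G v ≡⟨ cong (_+ degree G v) (+-comm (weight (removeAt f v)) (f v)) ⟩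
    f v + weight (removeAt f v) + degree G v ≡⟨ cong (_+ degree G v) (sym (weight-removeAt f v)) ⟩
    weight f + degree G v                    ∎
    where open ≤-Reasoning

mainTheorem16 : ∀ {m} (G : Graph (suc m)) (f : Fin (suc m) → ℕ) →
    IsGammaRFunction G f → (v : Fin (suc m)) →
    ∃ λ (g : Fin m → ℕ) → IsGammaRFunction (deleteVertex G v) g ×
      ((f v ≡ 0 → (weight f ≤ weight g + 1) × (weight g ≤ weight f)) ×
       (f v ≡ 1 → weight g + 1 ≡ weight f) ×
       (f v ≡ 2 → (weight f ≤ weight g + 1) × (weight g + 2 ≤ weight f + degree G v)))
mainTheorem16 {m} G f f-γ@(f-rdf , _) v = g , g-γ , case-0 , case-1 , case-2
  where
  g-exists : Σ (Fin m → ℕ) (IsGammaRFunction (deleteVertex G v))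
  g-exists = gammaRFunction-exists (deleteVertex G v) (raise G v f) (raise-RDF G v f-rdf)

  g : Fin m → ℕ
  g = proj₁ g-exists

  g-γ : IsGammaRFunction (deleteVertex G v) g
  g-γ = proj₂ g-exists

  lower : weight f ≤ weight g + 1
  lower = gamma-le-insert G v f-γ (proj₁ g-γ)

  upper : ∀ {k} → f v ≡ k → k ≢ 2 → weight g + k ≤ weight f
  upper refl k≢2 = gamma-le-restrict G v g-γ f-rdf k≢2

  case-0 : f v ≡ 0 → (weight f ≤ weight g + 1) × (weight g ≤ weight f)
  case-0 fv≡0 = lower , subst (_≤ weight f) (+-identityʳ (weight g)) (upper fv≡0 λ ())

  case-1 : f v ≡ 1 → weight g + 1 ≡ weight f
  case-1 fv≡1 = ≤-antisym (upper fv≡1 λ ()) lower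

  case-2 : f v ≡ 2 → (weight f ≤ weight g + 1) × (weight g + 2 ≤ weight f + degree G v)
  case-2 fv≡2 =
    lower , subst (λ k → weight g + k ≤ weight f + degree G v) fv≡2 (gamma-le-raise G v g-γ f-rdf)
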